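{- Let $n\ge 1$. There are no three distinct vectors $\vec x,\vec y,\vec z\in\mathbb R^n$ such that $\|\vec x\|=\|\vec y\|=\|\vec z\|=\|\vec x+\vec y\|=\|\vec x+\vec z\|=\|\vec y+\vec z\|=\|\vec x+\vec y+\vec z\|$.
   Context: $\|\cdot\|$ denotes the Euclidean norm on $\mathbb R^n$. -}

module Defs where

open import Level using (0ℓ) renaming (suc to lsuc)
open import Data.Nat using (ℕ)
open import Data.Vec using (Vec; zipWith; foldr)
open import Data.Product using (Σ; ∃; _×_)
open import Relation.Nullary using (¬_)
open import Relation.Binary.PropositionalEquality using (_≡_)
open import Algebra.Structures using (IsCommutativeRing)
open import Relation.Binary.Structures using (IsTotalOrder)

-- Axiomatic real numbers: a complete (Dedekind / least-upper-bound) ordered field.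
-- Any two such structures are isomorphic, so quantifying over all of them is
-- the same as speaking about ℝ.
record RealField : Set₁ where
  infixl 6 _+_
  infixl 7 _*_
  infix 4 _≤_
  field
    Carrier : Set
    0# 1# : Carrier
    _+_ _*_ : Carrier → Carrier → Carrier
    -_ : Carrier → Carrier
    _≤_ : Carrier → Carrier → Set
    isCommutativeRing : IsCommutativeRing _≡_ _+_ _*_ -_ 0# 1#
    0≢1 : ¬ (0# ≡ 1#)
    inverse : ∀ x → ¬ (x ≡ 0#) → ∃ λ y → x * y ≡ 1#
    isTotalOrder : IsTotalOrder _≡_ _≤_
    +-mono-≤ : ∀ {x y} z → x ≤ y → x + z ≤ y + z
    *-nonneg : ∀ {x y} → 0# ≤ x → 0# ≤ y → 0# ≤ x * y
    lub : (P : Carrier → Set) → ∃ P → (∃ λ b → ∀ x → P x → x ≤ b) →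
          ∃ λ s → (∀ x → P x → x ≤ s) × (∀ b → (∀ x → P x → x ≤ b) → s ≤ b)

  normSq : ∀ {n} → Vec Carrier n → Carrier
  normSq v = foldr _ _+_ 0# (zipWith _*_ v v)

  _⊕_ : ∀ {n} → Vec Carrier n → Vec Carrier n → Vec Carrier n
  _⊕_ = zipWith _+_

  NormIs : ∀ {n} → Vec Carrier n → Carrier → Set
  NormIs v r = (0# ≤ r) × (r * r ≡ normSq v)

ThreeEquinormVectors : (R : RealField) → ℕ → Set
ThreeEquinormVectors R n =
  Σ (Vec Carrier n) λ x → Σ (Vec Carrier n) λ y → Σ (Vec Carrier n) λ z →
    ¬ (x ≡ y) × ¬ (x ≡ z) × ¬ (y ≡ z) ×
    (∃ λ r → NormIs x r × NormIs y r × NormIs z r × NormIs (x ⊕ y) r ×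
             NormIs (x ⊕ z) r × NormIs (y ⊕ z) r × NormIs ((x ⊕ y) ⊕ z) r)
  where open RealField R

-- Hlawka's identity  ‖x+y+z‖² + ‖x‖² + ‖y‖² + ‖z‖² = ‖x+y‖² + ‖x+z‖² + ‖y+z‖²
-- turns seven equal norms r into 4r² = 3r², so r = 0. Then x = y = z = 0,
-- contradicting distinctness.
module Submission where

open import Defs
open import Data.Nat using (ℕ; _≤_)
open import Relation.Nullary using (¬_)

open import Level using (0ℓ)
open import Data.Maybe.Base using (nothing)
open import Data.Vec using (Vec; []; _∷_; replicate)
open import Data.Product using (_,_)
open import Data.Sum using (inj₁; inj₂)
open import Function using (_$_)
open import Algebra.Bundles using (CommutativeRing)
open import Effect.Monad using (RawMonad)
open import Relation.Nullary.Negation using (¬¬-Monad)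
open import Relation.Binary.PropositionalEquality
  using (_≡_; refl; sym; trans; cong; cong₂; subst; subst₂; module ≡-Reasoning)
open import Relation.Binary.Structures using (IsTotalOrder)

module _ (R : RealField) where
  open RealField R renaming (_≤_ to _≦_)

  commutativeRing : CommutativeRing 0ℓ 0ℓ
  commutativeRing = record { isCommutativeRing = isCommutativeRing }

  open CommutativeRing commutativeRing
    using (+-identityˡ; +-comm; -‿inverseʳ; *-identityˡ; zeroˡ; ring; commutativeSemiring; +-commutativeSemigroup)
  open import Algebra.Properties.Ring ring using (-‿distribˡ-*; -‿distribʳ-*; -‿involutive; +-cancelʳ)
  open import Algebra.Properties.CommutativeSemigroup +-commutativeSemigroup using (interchange)
  open import Algebra.Solver.Ring.NaturalCoefficients commutativeSemiring (λ _ _ → nothing)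
    using (solve; _:=_; _:+_; _:*_)
  open IsTotalOrder isTotalOrder using (total; antisym) renaming (refl to ≦-refl; trans to ≦-trans)
  open RawMonad (¬¬-Monad {0ℓ}) using (_<$>_; _⊛_)
  open ≡-Reasoning

  -x*-x≡x*x : ∀ x → (- x) * (- x) ≡ x * x
  -x*-x≡x*x x = begin
    (- x) * (- x)   ≡⟨ -‿distribˡ-* x (- x) ⟨
    - (x * - x)     ≡⟨ cong -_ (-‿distribʳ-* x x) ⟨
    - (- (x * x))   ≡⟨ -‿involutive (x * x) ⟩
    x * x           ∎

  x≦0⇒0≦-x : ∀ {x} → x ≦ 0# → 0# ≦ - x
  x≦0⇒0≦-x {x} x≦0 = subst₂ _≦_ (-‿inverseʳ x) (+-identityˡ (- x)) (+-mono-≤ (- x) x≦0)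

  0≦x*x : ∀ x → 0# ≦ x * x
  0≦x*x x with total 0# x
  ... | inj₁ 0≦x = *-nonneg 0≦x 0≦x
  ... | inj₂ x≦0 = subst (0# ≦_) (-x*-x≡x*x x) (*-nonneg 0≦-x 0≦-x)
    where 0≦-x = x≦0⇒0≦-x x≦0

  +-nonneg : ∀ {x y} → 0# ≦ x → 0# ≦ y → 0# ≦ x + y
  +-nonneg {x} {y} 0≦x 0≦y = ≦-trans 0≦y (subst (_≦ x + y) (+-identityˡ y) (+-mono-≤ y 0≦x))

  +-nonneg-≡0ˡ : ∀ {x y} → 0# ≦ x → 0# ≦ y → x + y ≡ 0# → x ≡ 0#
  +-nonneg-≡0ˡ {x} {y} 0≦x 0≦y x+y≡0 =
    antisym (subst₂ _≦_ (+-identityˡ x) (trans (+-comm y x) x+y≡0) (+-mono-≤ x 0≦y)) 0≦x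

  +-nonneg-≡0ʳ : ∀ {x y} → 0# ≦ x → 0# ≦ y → x + y ≡ 0# → y ≡ 0#
  +-nonneg-≡0ʳ {x} {y} 0≦x 0≦y x+y≡0 = +-nonneg-≡0ˡ 0≦y 0≦x (trans (+-comm y x) x+y≡0)

  -- Equality of reals is not decidable, so only the double negation is available.
  x*x≡0⇒¬¬x≡0 : ∀ x → x * x ≡ 0# → ¬ ¬ (x ≡ 0#)
  x*x≡0⇒¬¬x≡0 x x*x≡0 x≢0 with inverse x x≢0
  ... | y , x*y≡1 = 0≢1 (begin
    0#                ≡⟨ zeroˡ (y * y) ⟨
    0# * (y * y)      ≡⟨ cong (_* (y * y)) x*x≡0 ⟨
    (x * x) * (y * y) ≡⟨ solve 2 (λ x y → (x :* x) :* (y :* y) := (x :* y) :* (x :* y)) refl x y ⟩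
    (x * y) * (x * y) ≡⟨ cong₂ _*_ x*y≡1 x*y≡1 ⟩
    1# * 1#           ≡⟨ *-identityˡ 1# ⟩
    1#                ∎)

  normSq-nonneg : ∀ {n} (v : Vec Carrier n) → 0# ≦ normSq v
  normSq-nonneg []      = ≦-refl
  normSq-nonneg (x ∷ v) = +-nonneg (0≦x*x x) (normSq-nonneg v)

  normSq≡0⇒¬¬≡0 : ∀ {n} (v : Vec Carrier n) → normSq v ≡ 0# → ¬ ¬ (v ≡ replicate n 0#)
  normSq≡0⇒¬¬≡0 []      _    = _$ refl
  normSq≡0⇒¬¬≡0 (x ∷ v) ‖‖≡0 =
    cong₂ _∷_ <$> x*x≡0⇒¬¬x≡0 x (+-nonneg-≡0ˡ 0≦x² 0≦‖v‖ ‖‖≡0)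
              ⊛ normSq≡0⇒¬¬≡0 v (+-nonneg-≡0ʳ 0≦x² 0≦‖v‖ ‖‖≡0)
    where
    0≦x²  = 0≦x*x x
    0≦‖v‖ = normSq-nonneg v

  hlawka-identity-scalar : ∀ a b c →
    (a + b + c) * (a + b + c) + (a * a + b * b + c * c) ≡
    (a + b) * (a + b) + (a + c) * (a + c) + (b + c) * (b + c)
  hlawka-identity-scalar = solve 3 (λ a b c →
    (a :+ b :+ c) :* (a :+ b :+ c) :+ (a :* a :+ b :* b :+ c :* c) :=
    (a :+ b) :* (a :+ b) :+ (a :+ c) :* (a :+ c) :+ (b :+ c) :* (b :+ c)) refl

  interchange₃ : ∀ p q r s t u → (p + s) + (q + t) + (r + u) ≡ (p + q + r) + (s + t + u)
  interchange₃ p q r s t u = begin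
    (p + s) + (q + t) + (r + u) ≡⟨ cong (_+ (r + u)) (interchange p s q t) ⟩
    (p + q) + (s + t) + (r + u) ≡⟨ interchange (p + q) (s + t) r u ⟩
    (p + q + r) + (s + t + u)   ∎

  hlawka-identity : ∀ {n} (x y z : Vec Carrier n) →
    normSq ((x ⊕ y) ⊕ z) + (normSq x + normSq y + normSq z) ≡
    normSq (x ⊕ y) + normSq (x ⊕ z) + normSq (y ⊕ z)
  hlawka-identity []      []      []      = +-identityˡ (0# + 0# + 0#)
  hlawka-identity (a ∷ x) (b ∷ y) (c ∷ z) = begin
    (sq (a + b + c) + N ((x ⊕ y) ⊕ z)) + ((sq a + N x) + (sq b + N y) + (sq c + N z))
      ≡⟨ cong (sq (a + b + c) + N ((x ⊕ y) ⊕ z) +_) (interchange₃ (sq a) (sq b) (sq c) (N x) (N y) (N z)) ⟩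
    (sq (a + b + c) + N ((x ⊕ y) ⊕ z)) + ((sq a + sq b + sq c) + (N x + N y + N z))
      ≡⟨ interchange (sq (a + b + c)) _ _ _ ⟩
    (sq (a + b + c) + (sq a + sq b + sq c)) + (N ((x ⊕ y) ⊕ z) + (N x + N y + N z))
      ≡⟨ cong₂ _+_ (hlawka-identity-scalar a b c) (hlawka-identity x y z) ⟩
    (sq (a + b) + sq (a + c) + sq (b + c)) + (N (x ⊕ y) + N (x ⊕ z) + N (y ⊕ z))
      ≡⟨ interchange₃ (sq (a + b)) (sq (a + c)) (sq (b + c)) _ _ _ ⟨
    (sq (a + b) + N (x ⊕ y)) + (sq (a + c) + N (x ⊕ z)) + (sq (b + c) + N (y ⊕ z))
      ∎
    where
    sq : Carrier → Carrier
    sq t = t * t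
    N : ∀ {m} → Vec Carrier m → Carrier
    N = normSq

  ¬threeEquinormVectors : ∀ {n} → ¬ ThreeEquinormVectors R n
  ¬threeEquinormVectors (x , y , z , x≢y , _ , _ , r ,
      (_ , r²≡x) , (_ , r²≡y) , (_ , r²≡z) , (_ , r²≡x⊕y) , (_ , r²≡x⊕z) , (_ , r²≡y⊕z) , (_ , r²≡x⊕y⊕z)) =
    (λ x≡0 y≡0 → trans x≡0 (sym y≡0)) <$> normSq≡0⇒¬¬≡0 x (trans (sym r²≡x) r²≡0)
                                      ⊛ normSq≡0⇒¬¬≡0 y (trans (sym r²≡y) r²≡0)
      $ x≢y
    where
    r² = r * r
    r²≡0 : r² ≡ 0#
    r²≡0 = +-cancelʳ (r² + r² + r²) r² 0# (begin
      r² + (r² + r² + r²)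
        ≡⟨ cong₂ _+_ r²≡x⊕y⊕z (cong₂ _+_ (cong₂ _+_ r²≡x r²≡y) r²≡z) ⟩
      normSq ((x ⊕ y) ⊕ z) + (normSq x + normSq y + normSq z)
        ≡⟨ hlawka-identity x y z ⟩
      normSq (x ⊕ y) + normSq (x ⊕ z) + normSq (y ⊕ z)
        ≡⟨ cong₂ _+_ (cong₂ _+_ r²≡x⊕y r²≡x⊕z) r²≡y⊕z ⟨
      r² + r² + r²
        ≡⟨ +-identityˡ (r² + r² + r²) ⟨
      0# + (r² + r² + r²) ∎)

lemma3p1 : (R : RealField) → (n : ℕ) → 1 ≤ n → ¬ ThreeEquinormVectors R n
lemma3p1 R _ _ = ¬threeEquinormVectors R
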